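{- Fix $\alpha\in\{a,\bar a\}$. Assume that the rules of $f$ are exactly the following: - for every $\mu\in\mathcal A$, the rule $\dfrac{x_1\xrightarrow{\mu}y_1}{f(x_1,x_2)\xrightarrow{\mu}y_1\parallel x_2}$; - the single synchronisation rule $\dfrac{x_1\xrightarrow{\alpha}y_1\ \ x_2\xrightarrow{\bar\alpha}y_2}{f(x_1,x_2)\xrightarrow{\tau}y_1\parallel y_2}$. Assume also that $f$ distributes over $+$ in its first argument modulo bisimilarity. For $n\ge 0$ let $p_n=\sum_{i=0}^n\bar\alpha.\alpha^{\le i}$. Let $t\approx u$ be an equation between CCS$_f^-$ terms that is sound modulo bisimilarity, let $\sigma$ be a closed substitution, and put $p=\sigma(t)$, $q=\sigma(u)$. Suppose that $p$ and $q$ have neither $\mathbf 0$ summands nor $\mathbf 0$ factors, and that $p\,\underline{\leftrightarrow}\,f(\alpha,p_n)$ and $q\,\underline{\leftrightarrow}\,f(\alpha,p_n)$ for some $n$ larger than the size of $t$. If $p$ has a summand bisimilar to $f(\alpha,p_n)$, then so does $q$.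
   Context: Actions: $\mathcal A=\{a,\bar a,\tau\}$ with $a\ne\bar a$, $\bar{\bar a}=a$. CCS$_f^-$ terms: $t::=\mathbf 0\mid x\mid \mu.t\mid t+t\mid f(t,t)$. Semantics on closed terms: - $\mu.x\xrightarrow{\mu}x$; - standard nondeterministic choice; - standard CCS parallel composition $\parallel$ (interleaving, plus $\tau$-synchronisation of $\beta$ and $\bar\beta$), used in targets; - the rules for $f$. $\underline{\leftrightarrow}$ is strong bisimilarity; an equation $t\approx u$ is sound if $\sigma(t)\,\underline{\leftrightarrow}\,\sigma(u)$ for every closed substitution $\sigma$. A term has a $\mathbf 0$ factor if it contains a subterm $f(t',t'')$ with $t'$ or $t''$ bisimilar to $\mathbf 0$, and a $\mathbf 0$ summand if it contains a subterm $t'+t''$ with $t'$ or $t''$ bisimilar to $\mathbf 0$. Terms are modulo associativity and commutativity of $+$; the summands of $t_1+\dots+t_k$, with no $t_i$ headed by $+$, are the $t_i$. Size is the number of operator symbols. Notation: $\mu^0=\mathbf 0$, $\mu^{m+1}=\mu.\mu^m$, $\mu^{\le i}=\mu+\dots+\mu^i$ (with $\mu^{\le 0}=\mathbf 0$); $\alpha$ abbreviates $\alpha.\mathbf 0$. "$f$ distributes over $+$ in its first argument" means $f(x+y,z)\,\underline{\leftrightarrow}\,f(x,z)+f(y,z)$. -}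

module Defs where

open import Data.Empty using (⊥)
open import Data.Unit using (⊤)
open import Data.Nat using (ℕ; zero; suc; _+_)
open import Data.Product using (Σ; _×_; _,_; ∃)
open import Data.Sum using (_⊎_)
open import Relation.Binary.PropositionalEquality using (_≡_)
open import Relation.Nullary using (¬_)

data Act : Set where
  a ā τ : Act

-- complementation: bar a = ā, bar ā = a (bar τ = τ is never used for sync)
bar : Act → Act
bar a = ā
bar ā = a
bar τ = τ

infixr 6 _⊕_
data Term (V : Set) : Set where
  𝟘   : Term V
  var : V → Term V
  _∙_ : Act → Term V → Term V
  _⊕_ : Term V → Term V → Term V
  f   : Term V → Term V → Term V

OTerm : Set
OTerm = Term ℕ

CTerm : Set
CTerm = Term ⊥

subst : (ℕ → CTerm) → OTerm → CTerm
subst σ 𝟘       = 𝟘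
subst σ (var x) = σ x
subst σ (μ ∙ t) = μ ∙ subst σ t
subst σ (t ⊕ u) = subst σ t ⊕ subst σ u
subst σ (f t u) = f (subst σ t) (subst σ u)

size : OTerm → ℕ
size 𝟘       = 1
size (var _) = 0
size (μ ∙ t) = suc (size t)
size (t ⊕ u) = suc (size t + size u)
size (f t u) = suc (size t + size u)

-- Closed processes (CCS_f^- closed terms extended with ∥, used in targets)

data Proc : Set where
  𝟘   : Proc
  _∙_ : Act → Proc → Proc
  _⊕_ : Proc → Proc → Proc
  f   : Proc → Proc → Proc
  _∥_ : Proc → Proc → Proc

⟦_⟧ : CTerm → Proc
⟦ 𝟘 ⟧     = 𝟘
⟦ var () ⟧
⟦ μ ∙ t ⟧ = μ ∙ ⟦ t ⟧
⟦ t ⊕ u ⟧ = ⟦ t ⟧ ⊕ ⟦ u ⟧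
⟦ f t u ⟧ = f ⟦ t ⟧ ⟦ u ⟧

data Step (α : Act) : Proc → Act → Proc → Set where
  pre   : ∀ {μ p} → Step α (μ ∙ p) μ p
  sumL  : ∀ {p q μ p'} → Step α p μ p' → Step α (p ⊕ q) μ p'
  sumR  : ∀ {p q μ q'} → Step α q μ q' → Step α (p ⊕ q) μ q'
  parL  : ∀ {p q μ p'} → Step α p μ p' → Step α (p ∥ q) μ (p' ∥ q)
  parR  : ∀ {p q μ q'} → Step α q μ q' → Step α (p ∥ q) μ (p ∥ q')
  sync  : ∀ {p q p' q' β} → ¬ (β ≡ τ) →
          Step α p β p' → Step α q (bar β) q' → Step α (p ∥ q) τ (p' ∥ q')
  fL    : ∀ {p q μ p'} → Step α p μ p' → Step α (f p q) μ (p' ∥ q)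
  fSync : ∀ {p q p' q'} →
          Step α p α p' → Step α q (bar α) q' → Step α (f p q) τ (p' ∥ q')

IsBisim : Act → (Proc → Proc → Set) → Set
IsBisim α R = ∀ p q → R p q →
  (∀ μ p' → Step α p μ p' → Σ Proc λ q' → Step α q μ q' × R p' q') ×
  (∀ μ q' → Step α q μ q' → Σ Proc λ p' → Step α p μ p' × R p' q')

Bisim : Act → Proc → Proc → Set₁
Bisim α p q = Σ (Proc → Proc → Set) λ R → IsBisim α R × R p q

_⊢_↔_ : Act → CTerm → CTerm → Set₁
α ⊢ p ↔ q = Bisim α ⟦ p ⟧ ⟦ q ⟧

Sound : Act → OTerm → OTerm → Set₁
Sound α t u = ∀ (σ : ℕ → CTerm) → α ⊢ subst σ t ↔ subst σ u

Distributes : Act → Set₁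
Distributes α = ∀ (p q r : CTerm) → α ⊢ f (p ⊕ q) r ↔ (f p r ⊕ f q r)

data SubTerm {V : Set} : Term V → Term V → Set where
  here  : ∀ {t} → SubTerm t t
  inPre : ∀ {s μ t} → SubTerm s t → SubTerm s (μ ∙ t)
  inSL  : ∀ {s t u} → SubTerm s t → SubTerm s (t ⊕ u)
  inSR  : ∀ {s t u} → SubTerm s u → SubTerm s (t ⊕ u)
  inFL  : ∀ {s t u} → SubTerm s t → SubTerm s (f t u)
  inFR  : ∀ {s t u} → SubTerm s u → SubTerm s (f t u)

HasZeroSummand : Act → CTerm → Set₁
HasZeroSummand α p = Σ CTerm λ t' → Σ CTerm λ t'' →
  SubTerm (t' ⊕ t'') p × ((α ⊢ t' ↔ 𝟘) ⊎ (α ⊢ t'' ↔ 𝟘))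

HasZeroFactor : Act → CTerm → Set₁
HasZeroFactor α p = Σ CTerm λ t' → Σ CTerm λ t'' →
  SubTerm (f t' t'') p × ((α ⊢ t' ↔ 𝟘) ⊎ (α ⊢ t'' ↔ 𝟘))

NotSum : {V : Set} → Term V → Set
NotSum (_ ⊕ _) = ⊥
NotSum _       = ⊤

-- summands of a term modulo associativity/commutativity of +
data Summand {V : Set} : Term V → Term V → Set where
  self : ∀ {t} → NotSum t → Summand t t
  inL  : ∀ {s t u} → Summand s t → Summand s (t ⊕ u)
  inR  : ∀ {s t u} → Summand s u → Summand s (t ⊕ u)

pow : Act → ℕ → CTerm
pow μ zero    = 𝟘
pow μ (suc m) = μ ∙ pow μ m

upto : Act → ℕ → CTerm
upto μ zero          = 𝟘
upto μ (suc zero)    = pow μ 1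
upto μ (suc (suc i)) = upto μ (suc i) ⊕ pow μ (suc (suc i))

pN : Act → ℕ → CTerm
pN α zero    = bar α ∙ upto α zero
pN α (suc n) = pN α n ⊕ (bar α ∙ upto α (suc n))

target : Act → ℕ → CTerm
target α n = f (α ∙ 𝟘) (pN α n)

-- Two bisimulation invariants drive the argument: the depth of a process (its longest
-- computation) and whether it can ever perform ᾱ.  Let s be the summand of σ(t) bisimilar to
-- f(α, p_n).  If s comes from a variable summand x of t, replace σ(x) by the probe ᾱ.α^N with N
-- above the depth of σ(u).  The probed instance of t then has an ᾱ-step to a state of depth N
-- that never does ᾱ again, and by soundness the probed instance of u must match it, which is
-- only possible if x is a summand of u too.  Otherwise s = f(σ t', σ t'').  The τ-steps of
-- f(α, p_n) force σ t'' to have ᾱ-residuals of every depth 0, …, n, while a non-variable summand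
-- of t'' has them at a single depth; as t'' has at most n summands, one of them is a variable z,
-- and z does not occur in t' because σ t' never does ᾱ.  Probing z yields a τ-step to a state of
-- depth N without ᾱ, which the probed u can only match by a synchronisation in a summand
-- f(w₁, w₂) of u; a summand of σ(u) ↔ f(α, p_n) whose left factor can do α is itself bisimilar to
-- f(α, p_n).

module Submission where

open import Defs
open import Data.Empty using (⊥; ⊥-elim)
open import Data.Unit using (⊤; tt)
open import Data.Nat using (ℕ; zero; suc; _+_; _<_; _≤_; _⊔_; z≤n; s≤s; _≤?_; _≟_)
open import Data.Nat.Properties
open import Data.Fin using (Fin; toℕ)
open import Data.Fin.Properties using (pigeonhole; toℕ<n; toℕ-injective)
import Data.Fin.Properties as Fin
open import Data.List using (List; []; _∷_; _++_; length; lookup)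
open import Data.List.Properties using (length-++)
open import Data.List.Relation.Unary.Any using (here; index)
open import Data.List.Relation.Unary.Any.Properties using (lookup-index)
open import Data.List.Membership.Propositional using (_∈_)
open import Data.List.Membership.Propositional.Properties using (∈-++⁻; ∈-++⁺ˡ; ∈-++⁺ʳ)
open import Data.Product using (Σ; _×_; _,_; proj₁; proj₂; map₂)
open import Data.Sum using (_⊎_; inj₁; inj₂; [_,_])
open import Function using (flip; _∘_)
open import Relation.Nullary using (¬_; Dec; yes; no)
import Relation.Binary.PropositionalEquality as Eq
open Eq using (_≡_; _≢_; refl; sym; trans; cong; cong₂; subst₂)

private variable
  α β μ ν : Act
  p q p' q' x : Proc
  R : Proc → Proc → Set

-- The length of the longest computation; f p q moves only when p does.
depthᶠ : ℕ → ℕ → ℕ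
depthᶠ zero    _ = zero
depthᶠ (suc m) k = suc m + k

depth : Proc → ℕ
depth 𝟘       = 0
depth (μ ∙ p) = suc (depth p)
depth (p ⊕ q) = depth p ⊔ depth q
depth (f p q) = depthᶠ (depth p) (depth q)
depth (p ∥ q) = depth p + depth q

HasStep : Act → Proc → Set
HasStep α p = Σ Act λ μ → Σ Proc λ p' → Step α p μ p'

Dead : Act → Proc → Set
Dead α p = ∀ {μ p'} → ¬ Step α p μ p'

step-depth-< : Step α p μ p' → depth p' < depth p
step-depth-< pre = ≤-refl
step-depth-< {p = p ⊕ q} (sumL s) = <-≤-trans (step-depth-< s) (m≤m⊔n (depth p) (depth q))
step-depth-< {p = p ⊕ q} (sumR s) = <-≤-trans (step-depth-< s) (m≤n⊔m (depth p) (depth q))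
step-depth-< {p = p ∥ q} (parL s) = +-monoˡ-< (depth q) (step-depth-< s)
step-depth-< {p = p ∥ q} (parR s) = +-monoʳ-< (depth p) (step-depth-< s)
step-depth-< (sync _ s₁ s₂) = +-mono-< (step-depth-< s₁) (step-depth-< s₂)
step-depth-< {p = f p q} (fL s) with depth p | step-depth-< s
... | suc _ | lt = +-monoˡ-< (depth q) lt
step-depth-< {p = f p q} (fSync s₁ s₂) with depth p | step-depth-< s₁
... | suc _ | lt = +-mono-< lt (step-depth-< s₂)

HasStep⇒depth>0 : HasStep α p → 0 < depth p
HasStep⇒depth>0 (_ , _ , s) = ≤-<-trans z≤n (step-depth-< s)

depth-f : HasStep α p → depth (f p q) ≡ depth p + depth q
depth-f {p = p} h with depth p | HasStep⇒depth>0 h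
... | suc _ | _ = refl

depth-suc⇒step : ∀ p {k} → depth p ≡ suc k →
  Σ Act λ μ → Σ Proc λ p' → Step α p μ p' × depth p' ≡ k
depth-suc⇒step 𝟘 ()
depth-suc⇒step (μ ∙ p) refl = μ , p , pre , refl
depth-suc⇒step (p ⊕ q) eq with depth p ≤? depth q
... | yes p≤q with depth-suc⇒step q (trans (sym (m≤n⇒m⊔n≡n p≤q)) eq)
...   | μ , q' , s , e = μ , q' , sumR s , e
depth-suc⇒step (p ⊕ q) eq | no p≰q with depth-suc⇒step p (trans (sym (m≥n⇒m⊔n≡m (≰⇒≥ p≰q))) eq)
...   | μ , p' , s , e = μ , p' , sumL s , e
depth-suc⇒step (f p q) eq with depth p in ep
... | suc m with depth-suc⇒step p ep
...   | μ , p' , s , e = μ , p' ∥ q , fL s , trans (cong (_+ depth q) e) (suc-injective eq)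
depth-suc⇒step (p ∥ q) eq with depth p in ep
... | zero with depth-suc⇒step q eq
...   | μ , q' , s , e = μ , p ∥ q' , parR s , trans (cong (_+ depth q') ep) e
depth-suc⇒step (p ∥ q) eq | suc m with depth-suc⇒step p ep
...   | μ , p' , s , e = μ , p' ∥ q , parL s , trans (cong (_+ depth q) e) (suc-injective eq)

Dead⇒depth≡0 : ∀ p → Dead α p → depth p ≡ 0
Dead⇒depth≡0 p dead with depth p in ep
... | zero = refl
... | suc k with depth-suc⇒step p ep
...   | _ , _ , s , _ = ⊥-elim (dead s)

Simulation : Act → (Proc → Proc → Set) → Set
Simulation α R = ∀ {p q μ p'} → R p q → Step α p μ p' → Σ Proc λ q' → Step α q μ q' × R p' q'

forth : IsBisim α R → Simulation α R
forth isb {p} {q} r s = proj₁ (isb p q r) _ _ s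

back : IsBisim α R → Simulation α (flip R)
back isb {p} {q} r s = proj₂ (isb q p r) _ _ s

simulation-depth-≤ : Simulation α R → R p q → depth p ≤ depth q
simulation-depth-≤ {α = α} {R = R} sim r = go _ r refl
  where
    go : ∀ k → R p q → depth p ≡ k → k ≤ depth q
    go zero r e = z≤n
    go {p = p} (suc k) r e with depth-suc⇒step {α = α} p e
    ... | μ , p' , s , e' with sim r s
    ...   | q' , s' , r' = <-≤-trans (s≤s (go k r' e')) (step-depth-< s')

bisim-depth : IsBisim α R → R p q → depth p ≡ depth q
bisim-depth isb r = ≤-antisym (simulation-depth-≤ (forth isb) r) (simulation-depth-≤ (back isb) r)

data CanDo (α β : Act) : Proc → Set where
  now   : Step α p β p' → CanDo α β p
  later : Step α p μ p' → CanDo α β p' → CanDo α β p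

CanDo-sim : Simulation α R → R p q → CanDo α β p → CanDo α β q
CanDo-sim sim r (now s) with sim r s
... | _ , s' , _ = now s'
CanDo-sim sim r (later s c) with sim r s
... | _ , s' , r' = later s' (CanDo-sim sim r' c)

CanDo-∥ˡ : CanDo α β p → CanDo α β (p ∥ q)
CanDo-∥ˡ (now s)     = now (parL s)
CanDo-∥ˡ (later s c) = later (parL s) (CanDo-∥ˡ c)

CanDo-∥ʳ : CanDo α β q → CanDo α β (p ∥ q)
CanDo-∥ʳ (now s)     = now (parR s)
CanDo-∥ʳ (later s c) = later (parR s) (CanDo-∥ʳ c)

CanDo-⊕ˡ : CanDo α β p → CanDo α β (p ⊕ q)
CanDo-⊕ˡ (now s)     = now (sumL s)
CanDo-⊕ˡ (later s c) = later (sumL s) c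

CanDo-⊕ʳ : CanDo α β q → CanDo α β (p ⊕ q)
CanDo-⊕ʳ (now s)     = now (sumR s)
CanDo-⊕ʳ (later s c) = later (sumR s) c

CanDo-fˡ : CanDo α β p → CanDo α β (f p q)
CanDo-fˡ (now s)     = now (fL s)
CanDo-fˡ (later s c) = later (fL s) (CanDo-∥ˡ c)

CanDo-∥⁻ : β ≢ τ → CanDo α β (p ∥ q) → CanDo α β p ⊎ CanDo α β q
CanDo-∥⁻ β≢τ (now (parL s))     = inj₁ (now s)
CanDo-∥⁻ β≢τ (now (parR s))     = inj₂ (now s)
CanDo-∥⁻ β≢τ (now (sync _ _ _)) = ⊥-elim (β≢τ refl)
CanDo-∥⁻ β≢τ (later (parL s) c) with CanDo-∥⁻ β≢τ c
... | inj₁ c' = inj₁ (later s c')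
... | inj₂ c' = inj₂ c'
CanDo-∥⁻ β≢τ (later (parR s) c) with CanDo-∥⁻ β≢τ c
... | inj₁ c' = inj₁ c'
... | inj₂ c' = inj₂ (later s c')
CanDo-∥⁻ β≢τ (later (sync _ s₁ s₂) c) with CanDo-∥⁻ β≢τ c
... | inj₁ c' = inj₁ (later s₁ c')
... | inj₂ c' = inj₂ (later s₂ c')

Dead⇒¬CanDo : Dead α p → ¬ CanDo α β p
Dead⇒¬CanDo dead (now s)     = dead s
Dead⇒¬CanDo dead (later s _) = dead s

hasStep? : ∀ p → Dec (HasStep α p)
hasStep? 𝟘 = no λ { (_ , _ , ()) }
hasStep? (μ ∙ p) = yes (μ , p , pre)
hasStep? (p ⊕ q) with hasStep? p | hasStep? q
... | yes (μ , p' , s) | _ = yes (μ , p' , sumL s)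
... | no _ | yes (μ , q' , s) = yes (μ , q' , sumR s)
... | no ¬p | no ¬q = no λ { (μ , _ , sumL s) → ¬p (μ , _ , s) ; (μ , _ , sumR s) → ¬q (μ , _ , s) }
hasStep? (f p q) with hasStep? p
... | yes (μ , p' , s) = yes (μ , p' ∥ q , fL s)
... | no ¬p = no λ { (μ , _ , fL s) → ¬p (μ , _ , s) ; (_ , _ , fSync s _) → ¬p (_ , _ , s) }
hasStep? (p ∥ q) with hasStep? p | hasStep? q
... | yes (μ , p' , s) | _ = yes (μ , p' ∥ q , parL s)
... | no _ | yes (μ , q' , s) = yes (μ , p ∥ q' , parR s)
... | no ¬p | no ¬q = no λ { (μ , _ , parL s) → ¬p (μ , _ , s)
                          ; (μ , _ , parR s) → ¬q (μ , _ , s)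
                          ; (_ , _ , sync _ s _) → ¬p (_ , _ , s) }

¬↔𝟘⇒HasStep : ∀ c → ¬ (α ⊢ c ↔ 𝟘) → HasStep α ⟦ c ⟧
¬↔𝟘⇒HasStep {α} c ≁𝟘 with hasStep? ⟦ c ⟧
... | yes h = h
... | no ¬h = ⊥-elim (≁𝟘 (WithZero , isBisim , refl , refl))
  where
    WithZero : Proc → Proc → Set
    WithZero p q = p ≡ ⟦ c ⟧ × q ≡ 𝟘
    isBisim : IsBisim α WithZero
    isBisim _ _ (refl , refl) = (λ μ p' s → ⊥-elim (¬h (μ , p' , s))) , λ _ _ ()

∥-inv : μ ≢ τ → Step α (p ∥ q) μ x →
  (Σ Proc λ p' → Step α p μ p' × x ≡ p' ∥ q) ⊎ (Σ Proc λ q' → Step α q μ q' × x ≡ p ∥ q')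
∥-inv μ≢τ (parL s)     = inj₁ (_ , s , refl)
∥-inv μ≢τ (parR s)     = inj₂ (_ , s , refl)
∥-inv μ≢τ (sync _ _ _) = ⊥-elim (μ≢τ refl)

f-inv : μ ≢ τ → Step α (f p q) μ x → Σ Proc λ p' → Step α p μ p' × x ≡ p' ∥ q
f-inv μ≢τ (fL s)        = _ , s , refl
f-inv μ≢τ (fSync _ _)   = ⊥-elim (μ≢τ refl)

prefix-acts : Step α (μ ∙ p) ν x → ν ≡ μ
prefix-acts pre = refl

Summand-step : ∀ {c d} → Summand c d → Step α ⟦ c ⟧ μ x → Step α ⟦ d ⟧ μ x
Summand-step (self _) s = s
Summand-step (inL sm) s = sumL (Summand-step sm s)
Summand-step (inR sm) s = sumR (Summand-step sm s)

SubTerm-trans : ∀ {V} {s t u : Term V} → SubTerm s t → SubTerm t u → SubTerm s u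
SubTerm-trans st here      = st
SubTerm-trans st (inPre p) = inPre (SubTerm-trans st p)
SubTerm-trans st (inSL p)  = inSL (SubTerm-trans st p)
SubTerm-trans st (inSR p)  = inSR (SubTerm-trans st p)
SubTerm-trans st (inFL p)  = inFL (SubTerm-trans st p)
SubTerm-trans st (inFR p)  = inFR (SubTerm-trans st p)

SubTerm-subst : ∀ {σ s t} → SubTerm s t → SubTerm (subst σ s) (subst σ t)
SubTerm-subst here      = here
SubTerm-subst (inPre p) = inPre (SubTerm-subst p)
SubTerm-subst (inSL p)  = inSL (SubTerm-subst p)
SubTerm-subst (inSR p)  = inSR (SubTerm-subst p)
SubTerm-subst (inFL p)  = inFL (SubTerm-subst p)
SubTerm-subst (inFR p)  = inFR (SubTerm-subst p)

Summand⇒SubTerm : ∀ {V} {s t : Term V} → Summand s t → SubTerm s t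
Summand⇒SubTerm (self _) = here
Summand⇒SubTerm (inL sm) = inSL (Summand⇒SubTerm sm)
Summand⇒SubTerm (inR sm) = inSR (Summand⇒SubTerm sm)

Summand⇒NotSum : ∀ {V} {s t : Term V} → Summand s t → NotSum s
Summand⇒NotSum (self ns) = ns
Summand⇒NotSum (inL sm)  = Summand⇒NotSum sm
Summand⇒NotSum (inR sm)  = Summand⇒NotSum sm

Summand-subst : ∀ {σ v t s} → Summand v t → Summand s (subst σ v) → Summand s (subst σ t)
Summand-subst (self _) sm = sm
Summand-subst (inL p)  sm = inL (Summand-subst p sm)
Summand-subst (inR p)  sm = inR (Summand-subst p sm)

Summand-subst⁻ : ∀ {σ s} t → Summand s (subst σ t) →
  Σ OTerm λ v → Summand v t × Summand s (subst σ v)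
Summand-subst⁻ 𝟘       sm = 𝟘 , self tt , sm
Summand-subst⁻ (var x) sm = var x , self tt , sm
Summand-subst⁻ (μ ∙ t) sm = μ ∙ t , self tt , sm
Summand-subst⁻ (f t u) sm = f t u , self tt , sm
Summand-subst⁻ (t ⊕ u) (inL sm) with Summand-subst⁻ t sm
... | v , p , q = v , inL p , q
Summand-subst⁻ (t ⊕ u) (inR sm) with Summand-subst⁻ u sm
... | v , p , q = v , inR p , q

Summand-step-subst : ∀ {θ v t r} → Summand v t → Step α ⟦ subst θ v ⟧ μ r → Step α ⟦ subst θ t ⟧ μ r
Summand-step-subst (self _) s = s
Summand-step-subst (inL p)  s = sumL (Summand-step-subst p s)
Summand-step-subst (inR p)  s = sumR (Summand-step-subst p s)

size-Summand-≤ : ∀ {v t} → Summand v t → size v ≤ size t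
size-Summand-≤ (self _) = ≤-refl
size-Summand-≤ {t = t ⊕ u} (inL p) = ≤-trans (size-Summand-≤ p) (m≤n⇒m≤1+n (m≤m+n (size t) (size u)))
size-Summand-≤ {t = t ⊕ u} (inR p) = ≤-trans (size-Summand-≤ p) (m≤n⇒m≤1+n (m≤n+m (size u) (size t)))

summands : OTerm → List OTerm
summands (t ⊕ u) = summands t ++ summands u
summands t       = t ∷ []

∈summands⇒Summand : ∀ {v} t → v ∈ summands t → Summand v t
∈summands⇒Summand 𝟘       (here refl) = self tt
∈summands⇒Summand (var x) (here refl) = self tt
∈summands⇒Summand (μ ∙ t) (here refl) = self tt
∈summands⇒Summand (f t u) (here refl) = self tt
∈summands⇒Summand (t ⊕ u) m with ∈-++⁻ (summands t) m
... | inj₁ m' = inL (∈summands⇒Summand t m')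
... | inj₂ m' = inR (∈summands⇒Summand u m')

length-summands-≤ : ∀ t → length (summands t) ≤ suc (size t)
length-summands-≤ 𝟘       = s≤s z≤n
length-summands-≤ (var x) = s≤s z≤n
length-summands-≤ (μ ∙ t) = s≤s z≤n
length-summands-≤ (f t u) = s≤s z≤n
length-summands-≤ (t ⊕ u) = begin
  length (summands t ++ summands u)         ≡⟨ length-++ (summands t) ⟩
  length (summands t) + length (summands u) ≤⟨ +-mono-≤ (length-summands-≤ t) (length-summands-≤ u) ⟩
  suc (size t) + suc (size u)               ≡⟨ cong suc (+-suc (size t) (size u)) ⟩
  suc (suc (size t + size u))               ∎
  where open ≤-Reasoning

length-summands-factor-≤ : ∀ {t' t'' t} → Summand (f t' t'') t → length (summands t'') ≤ size t
length-summands-factor-≤ {t'} {t''} sm = begin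
  length (summands t'') ≤⟨ length-summands-≤ t'' ⟩
  suc (size t'')         ≤⟨ s≤s (m≤n+m (size t'') (size t')) ⟩
  size (f t' t'')        ≤⟨ size-Summand-≤ sm ⟩
  _                      ∎
  where open ≤-Reasoning

step-via-summands : ∀ {σ r} t → Step α ⟦ subst σ t ⟧ μ r →
  Σ OTerm λ v → v ∈ summands t × Step α ⟦ subst σ v ⟧ μ r
step-via-summands 𝟘       s = 𝟘 , here refl , s
step-via-summands (var x) s = var x , here refl , s
step-via-summands (μ ∙ t) s = μ ∙ t , here refl , s
step-via-summands (f t u) s = f t u , here refl , s
step-via-summands (t ⊕ u) (sumL s) with step-via-summands t s
... | v , m , s' = v , ∈-++⁺ˡ m , s'
step-via-summands (t ⊕ u) (sumR s) with step-via-summands u s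
... | v , m , s' = v , ∈-++⁺ʳ (summands t) m , s'

NotVar : OTerm → Set
NotVar (var _) = ⊥
NotVar _       = ⊤

varSummand? : ∀ t → (Σ ℕ λ z → Summand (var z) t) ⊎ (∀ v → v ∈ summands t → NotVar v)
varSummand? 𝟘       = inj₂ λ { _ (here refl) → tt }
varSummand? (var z) = inj₁ (z , self tt)
varSummand? (μ ∙ t) = inj₂ λ { _ (here refl) → tt }
varSummand? (f t u) = inj₂ λ { _ (here refl) → tt }
varSummand? (t ⊕ u) with varSummand? t | varSummand? u
... | inj₁ (z , p) | _            = inj₁ (z , inL p)
... | inj₂ _       | inj₁ (z , p) = inj₁ (z , inR p)
... | inj₂ ¬t      | inj₂ ¬u      = inj₂ λ v m → [ ¬t v , ¬u v ] (∈-++⁻ (summands t) m)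

data Occurs (z : ℕ) : OTerm → Set where
  var : Occurs z (var z)
  pre : ∀ {μ t} → Occurs z t → Occurs z (μ ∙ t)
  ⊕ˡ  : ∀ {t u} → Occurs z t → Occurs z (t ⊕ u)
  ⊕ʳ  : ∀ {t u} → Occurs z u → Occurs z (t ⊕ u)
  fˡ  : ∀ {t u} → Occurs z t → Occurs z (f t u)
  fʳ  : ∀ {t u} → Occurs z u → Occurs z (f t u)

occurs? : ∀ z t → Dec (Occurs z t)
occurs? z 𝟘 = no λ ()
occurs? z (var x) with x ≟ z
... | yes refl = yes var
... | no x≢z   = no λ { var → x≢z refl }
occurs? z (μ ∙ t) with occurs? z t
... | yes o = yes (pre o)
... | no ¬o = no λ { (pre o) → ¬o o }
occurs? z (t ⊕ u) with occurs? z t | occurs? z u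
... | yes o | _     = yes (⊕ˡ o)
... | no _  | yes o = yes (⊕ʳ o)
... | no ¬t | no ¬u = no λ { (⊕ˡ o) → ¬t o ; (⊕ʳ o) → ¬u o }
occurs? z (f t u) with occurs? z t | occurs? z u
... | yes o | _     = yes (fˡ o)
... | no _  | yes o = yes (fʳ o)
... | no ¬t | no ¬u = no λ { (fˡ o) → ¬t o ; (fʳ o) → ¬u o }

_[_≔_] : (ℕ → CTerm) → ℕ → CTerm → ℕ → CTerm
(σ [ z ≔ ρ ]) y with y ≟ z
... | yes _ = ρ
... | no _  = σ y

≔-same : ∀ σ z ρ → (σ [ z ≔ ρ ]) z ≡ ρ
≔-same σ z ρ with z ≟ z
... | yes _  = refl
... | no z≢z = ⊥-elim (z≢z refl)

≔-other : ∀ σ z ρ y → y ≢ z → (σ [ z ≔ ρ ]) y ≡ σ y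
≔-other σ z ρ y y≢z with y ≟ z
... | yes y≡z = ⊥-elim (y≢z y≡z)
... | no _    = refl

subst-fresh : ∀ σ z ρ t → ¬ Occurs z t → subst (σ [ z ≔ ρ ]) t ≡ subst σ t
subst-fresh σ z ρ 𝟘       ¬o = refl
subst-fresh σ z ρ (var x) ¬o = ≔-other σ z ρ x λ { refl → ¬o var }
subst-fresh σ z ρ (μ ∙ t) ¬o = cong (μ ∙_) (subst-fresh σ z ρ t (¬o ∘ pre))
subst-fresh σ z ρ (t ⊕ u) ¬o = cong₂ _⊕_ (subst-fresh σ z ρ t (¬o ∘ ⊕ˡ)) (subst-fresh σ z ρ u (¬o ∘ ⊕ʳ))
subst-fresh σ z ρ (f t u) ¬o = cong₂ f (subst-fresh σ z ρ t (¬o ∘ fˡ)) (subst-fresh σ z ρ u (¬o ∘ fʳ))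

pigeonhole-labelling : ∀ {A : Set} (L : List A) {n} (P : A → ℕ → Set) → length L ≤ n →
  ((i : Fin (suc n)) → Σ A λ v → v ∈ L × P v (toℕ i)) →
  (∀ {v i j} → v ∈ L → P v i → P v j → i ≡ j) → ⊥
pigeonhole-labelling L P len label unique
  with pigeonhole (s≤s len) (λ i → index (proj₁ (proj₂ (label i))))
... | i , j , i<j , same-index with label i | label j
...   | v , v∈L , Pv | w , w∈L , Pw =
  Fin.<⇒≢ i<j (toℕ-injective (unique v∈L Pv (Eq.subst (λ x → P x (toℕ j)) w≡v Pw)))
  where
    w≡v : w ≡ v
    w≡v = trans (lookup-index w∈L) (trans (cong (lookup L) (sym same-index)) (sym (lookup-index v∈L)))

bar≢self : α ≡ a ⊎ α ≡ ā → bar α ≢ α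
bar≢self (inj₁ refl) ()
bar≢self (inj₂ refl) ()

bar≢τ : α ≡ a ⊎ α ≡ ā → bar α ≢ τ
bar≢τ (inj₁ refl) ()
bar≢τ (inj₂ refl) ()

visible≢τ : α ≡ a ⊎ α ≡ ā → α ≢ τ
visible≢τ (inj₁ refl) ()
visible≢τ (inj₂ refl) ()

depth-pow : ∀ μ m → depth ⟦ pow μ m ⟧ ≡ m
depth-pow μ zero    = refl
depth-pow μ (suc m) = cong suc (depth-pow μ m)

depth-upto : ∀ μ i → depth ⟦ upto μ i ⟧ ≡ i
depth-upto μ zero          = refl
depth-upto μ (suc zero)    = refl
depth-upto μ (suc (suc i)) rewrite depth-upto μ (suc i) | depth-pow μ i = m≤n⇒m⊔n≡n (n≤1+n (suc i))

pow-acts : ∀ m → Step β ⟦ pow μ m ⟧ ν x → ν ≡ μ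
pow-acts (suc m) s = prefix-acts s

upto-acts : ∀ i → Step β ⟦ upto μ i ⟧ ν x → ν ≡ μ
upto-acts (suc zero)    s        = pow-acts 1 s
upto-acts (suc (suc i)) (sumL s) = upto-acts (suc i) s
upto-acts (suc (suc i)) (sumR s) = pow-acts (suc (suc i)) s

upto-step-𝟘 : ∀ j → Step β ⟦ upto μ (suc j) ⟧ μ 𝟘
upto-step-𝟘 zero    = pre
upto-step-𝟘 (suc j) = sumL (upto-step-𝟘 j)

pN-step : ∀ n {i} → i ≤ n → Step β ⟦ pN α n ⟧ (bar α) ⟦ upto α i ⟧
pN-step zero    z≤n = pre
pN-step (suc n) i≤1+n with m≤n⇒m<n∨m≡n i≤1+n
... | inj₁ (s≤s i≤n) = sumL (pN-step n i≤n)
... | inj₂ refl      = sumR pre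

pN-inv : ∀ n → Step β ⟦ pN α n ⟧ μ x → μ ≡ bar α × Σ ℕ λ i → x ≡ ⟦ upto α i ⟧
pN-inv zero    pre        = refl , zero , refl
pN-inv (suc n) (sumL s)   = pN-inv n s
pN-inv (suc n) (sumR pre) = refl , suc n , refl

𝟘∥pN-inv : ∀ n → Step β (𝟘 ∥ ⟦ pN α n ⟧) μ x → μ ≡ bar α × Σ ℕ λ i → x ≡ 𝟘 ∥ ⟦ upto α i ⟧
𝟘∥pN-inv n (parR s) with pN-inv n s
... | μ≡ᾱ , i , refl = μ≡ᾱ , i , refl

𝟘∥upto-acts : ∀ i → Step β (𝟘 ∥ ⟦ upto μ i ⟧) ν x → ν ≡ μ
𝟘∥upto-acts i (parR s) = upto-acts i s

target-α : ∀ n → Step α ⟦ target α n ⟧ α (𝟘 ∥ ⟦ pN α n ⟧)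
target-α n = fL pre

target-τ : ∀ n {i} → i ≤ n → Step α ⟦ target α n ⟧ τ (𝟘 ∥ ⟦ upto α i ⟧)
target-τ n i≤n = fSync pre (pN-step n i≤n)

target-inv : ∀ n → Step α ⟦ target α n ⟧ μ x →
  (μ ≡ α × x ≡ 𝟘 ∥ ⟦ pN α n ⟧) ⊎ (μ ≡ τ × Σ Proc λ y → Step α ⟦ pN α n ⟧ (bar α) y × x ≡ 𝟘 ∥ y)
target-inv n (fL pre)       = inj₁ (refl , refl)
target-inv n (fSync pre s₂) = inj₂ (refl , _ , s₂ , refl)

FactorsLive : Act → (ℕ → CTerm) → OTerm → Set
FactorsLive α σ t = ∀ {v₁ v₂} → SubTerm (f v₁ v₂) t →
  HasStep α ⟦ subst σ v₁ ⟧ × HasStep α ⟦ subst σ v₂ ⟧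

SummandsLive : Act → (ℕ → CTerm) → OTerm → Set
SummandsLive α σ t = ∀ {v₁ v₂} → SubTerm (v₁ ⊕ v₂) t →
  HasStep α ⟦ subst σ v₁ ⟧ × HasStep α ⟦ subst σ v₂ ⟧

FactorsLive-sub : ∀ {σ s t} → SubTerm s t → FactorsLive α σ t → FactorsLive α σ s
FactorsLive-sub st live st' = live (SubTerm-trans st' st)

SummandsLive-sub : ∀ {σ s t} → SubTerm s t → SummandsLive α σ t → SummandsLive α σ s
SummandsLive-sub st live st' = live (SubTerm-trans st' st)

¬↔𝟘⇒HasStep² : ∀ c₁ c₂ → ¬ ((α ⊢ c₁ ↔ 𝟘) ⊎ (α ⊢ c₂ ↔ 𝟘)) → HasStep α ⟦ c₁ ⟧ × HasStep α ⟦ c₂ ⟧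
¬↔𝟘⇒HasStep² c₁ c₂ ¬zero = ¬↔𝟘⇒HasStep c₁ (¬zero ∘ inj₁) , ¬↔𝟘⇒HasStep c₂ (¬zero ∘ inj₂)

¬HasZeroFactor⇒FactorsLive : ∀ σ t → ¬ HasZeroFactor α (subst σ t) → FactorsLive α σ t
¬HasZeroFactor⇒FactorsLive σ t ¬zero {v₁} {v₂} st =
  ¬↔𝟘⇒HasStep² (subst σ v₁) (subst σ v₂) λ zero → ¬zero (_ , _ , SubTerm-subst st , zero)

¬HasZeroSummand⇒SummandsLive : ∀ σ t → ¬ HasZeroSummand α (subst σ t) → SummandsLive α σ t
¬HasZeroSummand⇒SummandsLive σ t ¬zero {v₁} {v₂} st =
  ¬↔𝟘⇒HasStep² (subst σ v₁) (subst σ v₂) λ zero → ¬zero (_ , _ , SubTerm-subst st , zero)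

var-summand-HasStep : ∀ σ {z} t → SummandsLive α σ t → Summand (var z) t →
  HasStep α ⟦ subst σ t ⟧ → HasStep α ⟦ σ z ⟧
var-summand-HasStep σ _       live (self _) h = h
var-summand-HasStep σ (t ⊕ u) live (inL sm) _ =
  var-summand-HasStep σ t (SummandsLive-sub (inSL here) live) sm (proj₁ (live here))
var-summand-HasStep σ (t ⊕ u) live (inR sm) _ =
  var-summand-HasStep σ u (SummandsLive-sub (inSR here) live) sm (proj₂ (live here))

HasStep-subst-mono : ∀ σ θ → (∀ y → HasStep α ⟦ σ y ⟧ → HasStep α ⟦ θ y ⟧) →
  ∀ t → HasStep α ⟦ subst σ t ⟧ → HasStep α ⟦ subst θ t ⟧
HasStep-subst-mono σ θ h 𝟘 (_ , _ , ())
HasStep-subst-mono σ θ h (var y) hs = h y hs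
HasStep-subst-mono σ θ h (μ ∙ t) _  = μ , _ , pre
HasStep-subst-mono σ θ h (t ⊕ u) (μ , _ , sumL s) with HasStep-subst-mono σ θ h t (μ , _ , s)
... | ν , _ , s' = ν , _ , sumL s'
HasStep-subst-mono σ θ h (t ⊕ u) (μ , _ , sumR s) with HasStep-subst-mono σ θ h u (μ , _ , s)
... | ν , _ , s' = ν , _ , sumR s'
HasStep-subst-mono σ θ h (f t u) (μ , _ , fL s) with HasStep-subst-mono σ θ h t (μ , _ , s)
... | ν , _ , s' = ν , _ , fL s'
HasStep-subst-mono σ θ h (f t u) (_ , _ , fSync s _) with HasStep-subst-mono σ θ h t (_ , _ , s)
... | ν , _ , s' = ν , _ , fL s'

FactorsLive-mono : ∀ σ θ → (∀ y → HasStep α ⟦ σ y ⟧ → HasStep α ⟦ θ y ⟧) →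
  ∀ {t} → FactorsLive α σ t → FactorsLive α θ t
FactorsLive-mono σ θ h live {v₁} {v₂} st =
  HasStep-subst-mono σ θ h v₁ (proj₁ (live st)) , HasStep-subst-mono σ θ h v₂ (proj₂ (live st))

-- A variable inside a right factor is reached after its (live) left factor has moved.
Occurs⇒CanDo : ∀ θ {z} t → Occurs z t → CanDo α β ⟦ θ z ⟧ → FactorsLive α θ t → CanDo α β ⟦ subst θ t ⟧
Occurs⇒CanDo θ _       var     c live = c
Occurs⇒CanDo θ (μ ∙ t) (pre o) c live = later pre (Occurs⇒CanDo θ t o c (FactorsLive-sub (inPre here) live))
Occurs⇒CanDo θ (t ⊕ u) (⊕ˡ o)  c live = CanDo-⊕ˡ (Occurs⇒CanDo θ t o c (FactorsLive-sub (inSL here) live))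
Occurs⇒CanDo θ (t ⊕ u) (⊕ʳ o)  c live = CanDo-⊕ʳ (Occurs⇒CanDo θ u o c (FactorsLive-sub (inSR here) live))
Occurs⇒CanDo θ (f t u) (fˡ o)  c live = CanDo-fˡ (Occurs⇒CanDo θ t o c (FactorsLive-sub (inFL here) live))
Occurs⇒CanDo θ (f t u) (fʳ o)  c live with proj₁ (live here)
... | _ , _ , s = later (fL s) (CanDo-∥ʳ (Occurs⇒CanDo θ u o c (FactorsLive-sub (inFR here) live)))

module Visible (α : Act) (vis : α ≡ a ⊎ α ≡ ā) where

  ᾱ : Act
  ᾱ = bar α

  ᾱ≢α : ᾱ ≢ α
  ᾱ≢α = bar≢self vis

  ᾱ≢τ : ᾱ ≢ τ
  ᾱ≢τ = bar≢τ vis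

  α≢τ : α ≢ τ
  α≢τ = visible≢τ vis

  ¬CanDo-ᾱ-pow : ∀ m → ¬ CanDo α ᾱ ⟦ pow α m ⟧
  ¬CanDo-ᾱ-pow zero    c             = Dead⇒¬CanDo (λ ()) c
  ¬CanDo-ᾱ-pow (suc m) (now s)       = ᾱ≢α (pow-acts (suc m) s)
  ¬CanDo-ᾱ-pow (suc m) (later pre c) = ¬CanDo-ᾱ-pow m c

  module _ {R : Proc → Proc → Set} (isb : IsBisim α R) (n : ℕ) where

    right-acts-ᾱ : R (x ∥ q) (𝟘 ∥ ⟦ pN α n ⟧) → Step α q μ q' → μ ≡ ᾱ
    right-acts-ᾱ r s with forth isb r (parR s)
    ... | _ , s' , _ = proj₁ (𝟘∥pN-inv n s')

    left-dead : HasStep α q → R (x ∥ q) (𝟘 ∥ ⟦ pN α n ⟧) → Dead α x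
    left-dead (_ , _ , sq) r sx with forth isb r (parL sx)
    ... | _ , s , r' with 𝟘∥pN-inv n s
    ...   | refl , i , refl with forth isb r' (parR sq)
    ...     | _ , s' , _ = ᾱ≢α (trans (sym (right-acts-ᾱ r sq)) (𝟘∥upto-acts i s'))

    -- The partner 𝟘 ∥ α^{≤i} of the ᾱ-residual can reach a dead state by a single α.
    ᾱ-residual-left-depth≡0 : ∀ {e₁ e₂} → Dead α x → R (x ∥ q) (𝟘 ∥ ⟦ pN α n ⟧) →
      Step α q ᾱ (e₁ ∥ e₂) → HasStep α e₂ → depth e₁ ≡ 0
    ᾱ-residual-left-depth≡0 {x = x} {e₁ = e₁} {e₂} dead r s (_ , _ , se₂) with forth isb r (parR s)
    ... | _ , s' , r' with 𝟘∥pN-inv n s'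
    ...   | _ , zero , refl =
      ⊥-elim (<-irrefl (sym (bisim-depth isb r'))
        (HasStep⇒depth>0 {p = x ∥ (e₁ ∥ e₂)} (_ , _ , parR (parR se₂))))
    ...   | _ , suc j , refl with back isb r' (parR (upto-step-𝟘 j))
    ...     | _ , parL sx , _     = ⊥-elim (dead sx)
    ...     | _ , sync _ sx _ , _ = ⊥-elim (dead sx)
    ...     | _ , parR sw , r''   = residual sw (m+n≡0⇒n≡0 (depth x) (bisim-depth isb r''))
      where
        residual : ∀ {w} → Step α (e₁ ∥ e₂) α w → depth w ≡ 0 → depth e₁ ≡ 0
        residual (parL {p' = e₁'} _) eq =
          ⊥-elim (<-irrefl (sym (m+n≡0⇒n≡0 (depth e₁') eq)) (HasStep⇒depth>0 (_ , _ , se₂)))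
        residual (parR _)       eq = m+n≡0⇒m≡0 (depth e₁) eq
        residual (sync _ _ _)   eq = ⊥-elim (α≢τ refl)

    record LeftMove (P₁ P₂ : Proc) : Set where
      field
        residual : Proc
        step     : Step α P₁ α residual
        dead     : Dead α residual
        related  : R (residual ∥ P₂) (𝟘 ∥ ⟦ pN α n ⟧)

    module _ {P₁ P₂ : Proc} (r : R (f P₁ P₂) ⟦ target α n ⟧) (live : HasStep α P₂) where

      left-move : LeftMove P₁ P₂
      left-move with back isb r (target-α n)
      ... | _ , fL s , r'     = record { step = s ; dead = left-dead live r' ; related = r' }
      ... | _ , fSync _ _ , _ = ⊥-elim (α≢τ refl)

      left-steps : Step α P₁ μ p' → μ ≡ α × Dead α p'
      left-steps s with forth isb r (fL s)
      ... | _ , s' , r' with target-inv n s'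
      ... | inj₁ (refl , refl) = refl , left-dead live r'
      ... | inj₂ (refl , _ , sy , refl) with pN-inv n sy
      ...   | _ , i , refl with forth isb r' (parR (proj₂ (proj₂ live)))
      ...     | _ , s'' , _ = ⊥-elim (ᾱ≢α (trans
                  (sym (right-acts-ᾱ (LeftMove.related left-move) (proj₂ (proj₂ live))))
                  (𝟘∥upto-acts i s'')))

      right-ᾱ-depths : ∀ {i} → i ≤ n → Σ Proc λ q → Step α P₂ ᾱ q × depth q ≡ i
      right-ᾱ-depths {i} i≤n with back isb r (target-τ n i≤n)
      ... | _ , fL s , _ = ⊥-elim (α≢τ (sym (proj₁ (left-steps s))))
      ... | _ , fSync {p' = c} {q' = q} s₁ s₂ , r' = q , s₂ , (begin
        depth q           ≡⟨ cong (_+ depth q) (sym (Dead⇒depth≡0 c (proj₂ (left-steps s₁)))) ⟩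
        depth c + depth q ≡⟨ bisim-depth isb r' ⟩
        depth ⟦ upto α i ⟧ ≡⟨ depth-upto α i ⟩
        i                 ∎)
        where open Eq.≡-Reasoning

  summand↔target : ∀ n {q c₁ c₂} → α ⊢ q ↔ target α n → Summand (f c₁ c₂) q →
    Σ Proc (Step α ⟦ c₁ ⟧ α) → HasStep α ⟦ c₂ ⟧ → α ⊢ f c₁ c₂ ↔ target α n
  summand↔target n {c₁ = c₁} {c₂} (R , isb , r) sm (d , s₁) live = R⁺ , isb⁺ , inj₁ (refl , refl)
    where
      rd : R (d ∥ ⟦ c₂ ⟧) (𝟘 ∥ ⟦ pN α n ⟧)
      rd with forth isb r (Summand-step sm (fL s₁))
      ... | _ , s , r' with target-inv n s
      ...   | inj₁ (_ , refl) = r'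
      ...   | inj₂ (α≡τ , _)  = ⊥-elim (α≢τ α≡τ)

      R⁺ : Proc → Proc → Set
      R⁺ p q = (p ≡ ⟦ f c₁ c₂ ⟧ × q ≡ ⟦ target α n ⟧) ⊎ R p q

      back-target : ∀ {μ q} → Step α ⟦ target α n ⟧ μ q → Σ Proc λ p → Step α ⟦ f c₁ c₂ ⟧ μ p × R⁺ p q
      back-target s with target-inv n s
      ... | inj₁ (refl , refl) = d ∥ ⟦ c₂ ⟧ , fL s₁ , inj₂ rd
      ... | inj₂ (refl , _ , s₂ , refl) with back isb rd (parR s₂)
      ...   | _ , s , r' with ∥-inv ᾱ≢τ s
      ...     | inj₁ (_ , sd , _)    = ⊥-elim (left-dead isb n live rd sd)
      ...     | inj₂ (_ , sc , refl) = _ , fSync s₁ sc , inj₂ r'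

      isb⁺ : IsBisim α R⁺
      isb⁺ _ _ (inj₁ (refl , refl)) =
        (λ _ _ s → map₂ (map₂ inj₂) (forth isb r (Summand-step sm s))) , λ _ _ → back-target
      isb⁺ _ _ (inj₂ r) =
        (λ _ _ s → map₂ (map₂ inj₂) (forth isb r s)) , λ _ _ s → map₂ (map₂ inj₂) (back isb r s)

  module Probe (σ : ℕ → CTerm) (z N : ℕ) where

    σ' : ℕ → CTerm
    σ' = σ [ z ≔ ᾱ ∙ pow α N ]

    σ'z-step : Step α ⟦ σ' z ⟧ ᾱ ⟦ pow α N ⟧
    σ'z-step rewrite ≔-same σ z (ᾱ ∙ pow α N) = pre

    σ'-HasStep : ∀ y → HasStep α ⟦ σ y ⟧ → HasStep α ⟦ σ' y ⟧
    σ'-HasStep y h with y ≟ z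
    ... | yes _ = _ , _ , pre
    ... | no _  = h

    α-step-σ'⇒σ : ∀ w {μ r} → μ ≡ α → Step α ⟦ subst σ' w ⟧ μ r → Σ Proc (Step α ⟦ subst σ w ⟧ μ)
    α-step-σ'⇒σ 𝟘 _ ()
    α-step-σ'⇒σ (var y) μ≡α s with y ≟ z
    α-step-σ'⇒σ (var y) ᾱ≡α pre | yes _ = ⊥-elim (ᾱ≢α ᾱ≡α)
    ... | no _ = _ , s
    α-step-σ'⇒σ (μ ∙ w) _ pre = _ , pre
    α-step-σ'⇒σ (w ⊕ w') μ≡α (sumL s) = map₂ sumL (α-step-σ'⇒σ w μ≡α s)
    α-step-σ'⇒σ (w ⊕ w') μ≡α (sumR s) = map₂ sumR (α-step-σ'⇒σ w' μ≡α s)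
    α-step-σ'⇒σ (f w w') μ≡α (fL s) = _ , fL (proj₂ (α-step-σ'⇒σ w μ≡α s))
    α-step-σ'⇒σ (f w w') τ≡α (fSync _ _) = ⊥-elim (α≢τ (sym τ≡α))

    probe-free : ∀ w → FactorsLive α σ w → ¬ CanDo α ᾱ ⟦ subst σ' w ⟧ → subst σ' w ≡ subst σ w
    probe-free w live ¬c with occurs? z w
    ... | yes o = ⊥-elim (¬c (Occurs⇒CanDo σ' w o (now σ'z-step)
                                (FactorsLive-mono σ σ' σ'-HasStep live)))
    ... | no ¬o = subst-fresh σ z _ w ¬o

    data Origin (w : OTerm) (μ : Act) (r : Proc) : Set where
      from-probe : μ ≡ ᾱ → N ≤ depth r → Summand (var z) w ⊎ N < depth r → Origin w μ r
      from-sync  : ∀ {w₁ w₂} → μ ≡ τ → Summand (f w₁ w₂) w → Σ Proc (Step α ⟦ subst σ w₁ ⟧ α) →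
                   Origin w μ r

    Origin-summands : ∀ {w w' μ r} → (∀ {v} → Summand v w → Summand v w') → Origin w μ r → Origin w' μ r
    Origin-summands emb (from-probe e le (inj₁ sm)) = from-probe e le (inj₁ (emb sm))
    Origin-summands emb (from-probe e le (inj₂ lt)) = from-probe e le (inj₂ lt)
    Origin-summands emb (from-sync e sm h)          = from-sync e (emb sm) h

    -- A residual of σ' w deeper than σ w has to contain the probe's α^N unless
    -- it arose from a synchronisation; if it can never do ᾱ again, the probe fired.
    origin : ∀ w {μ r} → FactorsLive α σ w → Step α ⟦ subst σ' w ⟧ μ r → ¬ CanDo α ᾱ r →
      depth ⟦ subst σ w ⟧ < depth r → Origin w μ r
    origin 𝟘 live () ¬c lt
    origin (var y) live s ¬c lt with y ≟ z
    origin (var y) live pre ¬c lt | yes refl =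
      from-probe refl (≤-reflexive (sym (depth-pow α N))) (inj₁ (self tt))
    ... | no _ = ⊥-elim (<-asym lt (step-depth-< s))
    origin (μ ∙ w) live pre ¬c lt rewrite probe-free w (FactorsLive-sub (inPre here) live) ¬c =
      ⊥-elim (<-asym lt (n<1+n _))
    origin (w ⊕ w') live (sumL s) ¬c lt =
      Origin-summands inL (origin w (FactorsLive-sub (inSL here) live) s ¬c (≤-<-trans (m≤m⊔n _ _) lt))
    origin (w ⊕ w') live (sumR s) ¬c lt =
      Origin-summands inR (origin w' (FactorsLive-sub (inSR here) live) s ¬c (≤-<-trans (m≤n⊔m _ _) lt))
    origin (f w w') live (fSync s₁ _) ¬c lt = from-sync refl (self tt) (α-step-σ'⇒σ w refl s₁)
    origin (f w w') live (fL {p' = r₁} s) ¬c lt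
      with origin w (FactorsLive-sub (inFL here) live) s (¬c ∘ CanDo-∥ˡ) left-deeper
      where
        right-fixed : depth ⟦ subst σ' w' ⟧ ≡ depth ⟦ subst σ w' ⟧
        right-fixed = cong (depth ∘ ⟦_⟧)
          (probe-free w' (FactorsLive-sub (inFR here) live) (¬c ∘ CanDo-∥ʳ))
        left-deeper : depth ⟦ subst σ w ⟧ < depth r₁
        left-deeper = +-cancelʳ-< (depth ⟦ subst σ w' ⟧) _ _
          (subst₂ _<_ (depth-f {q = ⟦ subst σ w' ⟧} (proj₁ (live here)))
                      (cong (depth r₁ +_) right-fixed) lt)
    ... | from-probe e le _ = from-probe e (≤-trans le (m≤m+n _ _))
                                (inj₂ (≤-<-trans le (m<m+n (depth r₁) (HasStep⇒depth>0 right-live))))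
      where
        right-live : HasStep α ⟦ subst σ' w' ⟧
        right-live = proj₂ (FactorsLive-mono σ σ' σ'-HasStep live here)
    ... | from-sync e sm (_ , sd) = from-sync e (self tt) (_ , Summand-step-subst sm (fL sd))

  𝟘≁target : ∀ n → ¬ (α ⊢ 𝟘 ↔ target α n)
  𝟘≁target n (R , isb , r) with back isb r (target-α n)
  ... | _ , () , _

  prefix≁target : ∀ n {μ c} → ¬ (α ⊢ μ ∙ c ↔ target α n)
  prefix≁target n (R , isb , r) with back isb r (target-α n) | back isb r (target-τ n z≤n)
  ... | _ , s₁ , _ | _ , s₂ , _ = α≢τ (trans (prefix-acts s₁) (sym (prefix-acts s₂)))

  module FactorOfTarget (n : ℕ) (σ : ℕ → CTerm) {t' t'' : OTerm}
    (bisim : α ⊢ f (subst σ t') (subst σ t'') ↔ target α n) (live : FactorsLive α σ (f t' t'')) where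

    private
      isb = proj₁ (proj₂ bisim)
      r   = proj₂ (proj₂ bisim)
      right-live : HasStep α ⟦ subst σ t'' ⟧
      right-live = proj₂ (live here)

    open LeftMove (left-move isb n r right-live) public

    ¬left-ᾱ : ¬ CanDo α ᾱ ⟦ subst σ t' ⟧
    ¬left-ᾱ (now s)     = ᾱ≢α (proj₁ (left-steps isb n r right-live s))
    ¬left-ᾱ (later s c) = Dead⇒¬CanDo (proj₂ (left-steps isb n r right-live s)) c

    ᾱ-residual-of-depth : OTerm → ℕ → Set
    ᾱ-residual-of-depth v i = Σ Proc λ q → Step α ⟦ subst σ v ⟧ ᾱ q × depth q ≡ i

    ᾱ-residuals-of-all-depths : (i : Fin (suc n)) →
      Σ OTerm λ v → v ∈ summands t'' × ᾱ-residual-of-depth v (toℕ i)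
    ᾱ-residuals-of-all-depths i with right-ᾱ-depths isb n r right-live (≤-pred (toℕ<n i))
    ... | q , s , d with step-via-summands t'' s
    ...   | v , v∈t'' , sv = v , v∈t'' , q , sv , d

    ᾱ-residual-depth-unique : ∀ {v i j} → v ∈ summands t'' → NotVar v →
      ᾱ-residual-of-depth v i → ᾱ-residual-of-depth v j → i ≡ j
    ᾱ-residual-depth-unique {v} v∈t'' v-not-var (_ , s₁ , d₁) (_ , s₂ , d₂) =
      trans (sym d₁) (trans (same-depth v (∈summands⇒Summand t'' v∈t'') v-not-var s₁ s₂) d₂)
      where
        same-depth : ∀ v → Summand v t'' → NotVar v → ∀ {q₁ q₂} →
          Step α ⟦ subst σ v ⟧ ᾱ q₁ → Step α ⟦ subst σ v ⟧ ᾱ q₂ → depth q₁ ≡ depth q₂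
        same-depth 𝟘         _   _ ()
        same-depth (μ ∙ v)   _   _ pre pre = refl
        same-depth (_ ⊕ _)   v∈t _ _ _     = ⊥-elim (Summand⇒NotSum v∈t)
        same-depth (f v₁ v₂) v∈t _ s₁ s₂   = trans (residual-depth s₁) (sym (residual-depth s₂))
          where
            residual-depth : ∀ {q} → Step α ⟦ subst σ (f v₁ v₂) ⟧ ᾱ q → depth q ≡ depth ⟦ subst σ v₂ ⟧
            residual-depth s with f-inv ᾱ≢τ s
            ... | _ , s' , refl = cong (_+ depth ⟦ subst σ v₂ ⟧)
              (ᾱ-residual-left-depth≡0 isb n dead related (Summand-step-subst v∈t (fL s'))
                (proj₂ (live (inFR (Summand⇒SubTerm v∈t)))))

    right-var-summand : length (summands t'') ≤ n → Σ ℕ λ z → Summand (var z) t''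
    right-var-summand len with varSummand? t''
    ... | inj₁ found = found
    ... | inj₂ ¬var  = ⊥-elim (pigeonhole-labelling (summands t'') ᾱ-residual-of-depth len
                         ᾱ-residuals-of-all-depths
                         (λ v∈t'' → ᾱ-residual-depth-unique v∈t'' (¬var _ v∈t'')))

    right-var-fresh : SummandsLive α σ t'' → ∀ {z} → Summand (var z) t'' → ¬ Occurs z t'
    right-var-fresh sum-live {z} z∈t'' z∈t' =
      ¬left-ᾱ (Occurs⇒CanDo σ t' z∈t' z-ᾱ (FactorsLive-sub (inFL here) live))
      where
        z-ᾱ : CanDo α ᾱ ⟦ σ z ⟧
        z-ᾱ with var-summand-HasStep σ t'' sum-live z∈t'' right-live
        ... | _ , _ , sz = now (Eq.subst (λ μ → Step α ⟦ σ z ⟧ μ _)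
                                 (right-acts-ᾱ isb n related (Summand-step-subst z∈t'' sz)) sz)

  module _ {t u : OTerm} (sound : Sound α t u) (σ : ℕ → CTerm) (live-u : FactorsLive α σ u) where

    -- deeper than anything σ u can reach
    private
      N : ℕ
      N = suc (depth ⟦ subst σ u ⟧)

    probe-matched : ∀ z {μ p} → Step α ⟦ subst (Probe.σ' σ z N) t ⟧ μ p → ¬ CanDo α ᾱ p → depth p ≡ N →
      Σ Proc λ q → Probe.Origin σ z N u μ q × depth q ≡ N
    probe-matched z s ¬c dp with sound (Probe.σ' σ z N)
    ... | R , isb , r with forth isb r s
    ...   | q , sq , rq =
      q , Probe.origin σ z N u live-u sq (¬c ∘ CanDo-sim (back isb) rq) (≤-reflexive (sym dq)) , dq
      where
        dq : depth q ≡ N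
        dq = trans (sym (bisim-depth isb rq)) dp

    var-summand-preserved : ∀ {z} → Summand (var z) t → Summand (var z) u
    var-summand-preserved {z} z∈t
      with probe-matched z (Summand-step-subst z∈t (Probe.σ'z-step σ z N))
             (¬CanDo-ᾱ-pow N) (depth-pow α N)
    ... | _ , Probe.from-probe _ _ (inj₁ z∈u) , _ = z∈u
    ... | _ , Probe.from-probe _ _ (inj₂ N<d) , d = ⊥-elim (<-irrefl (sym d) N<d)
    ... | _ , Probe.from-sync ᾱ≡τ _ _ , _       = ⊥-elim (ᾱ≢τ ᾱ≡τ)

    sync-summand-matched : ∀ {z t' t'' c} → Summand (f t' t'') t → Summand (var z) t'' → ¬ Occurs z t' →
      Step α ⟦ subst σ t' ⟧ α c → Dead α c →
      Σ OTerm λ w₁ → Σ OTerm λ w₂ → Summand (f w₁ w₂) u × Σ Proc (Step α ⟦ subst σ w₁ ⟧ α)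
    sync-summand-matched {z} {t'} {t''} {c} ft∈t z∈t'' z∉t' sc dead
      with probe-matched z (Summand-step-subst {θ = Probe.σ' σ z N} ft∈t sync-step) ¬ᾱ
             (trans (cong (_+ _) (Dead⇒depth≡0 c dead)) (depth-pow α N))
      where
        sync-step : Step α ⟦ subst (Probe.σ' σ z N) (f t' t'') ⟧ τ (c ∥ ⟦ pow α N ⟧)
        sync-step rewrite subst-fresh σ z (ᾱ ∙ pow α N) t' z∉t' =
          fSync sc (Summand-step-subst {θ = Probe.σ' σ z N} z∈t'' (Probe.σ'z-step σ z N))
        ¬ᾱ : ¬ CanDo α ᾱ (c ∥ ⟦ pow α N ⟧)
        ¬ᾱ cd with CanDo-∥⁻ ᾱ≢τ cd
        ... | inj₁ cc = Dead⇒¬CanDo dead cc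
        ... | inj₂ cp = ¬CanDo-ᾱ-pow N cp
    ... | _ , Probe.from-sync _ w∈u left-α , _ = _ , _ , w∈u , left-α
    ... | _ , Probe.from-probe τ≡ᾱ _ _ , _    = ⊥-elim (ᾱ≢τ (sym τ≡ᾱ))

proposition9 : (α : Act) → (α ≡ a ⊎ α ≡ ā) → Distributes α →
    (t u : OTerm) → Sound α t u → (σ : ℕ → CTerm) →
    ¬ HasZeroSummand α (subst σ t) → ¬ HasZeroFactor α (subst σ t) →
    ¬ HasZeroSummand α (subst σ u) → ¬ HasZeroFactor α (subst σ u) →
    (n : ℕ) → size t < n →
    α ⊢ subst σ t ↔ target α n → α ⊢ subst σ u ↔ target α n →
    Σ CTerm (λ s → Summand s (subst σ t) × α ⊢ s ↔ target α n) →
    Σ CTerm (λ s → Summand s (subst σ u) × α ⊢ s ↔ target α n)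
proposition9 α vis _ t u sound σ ¬0s-t ¬0f-t _ ¬0f-u n size<n _ u↔T (s , s∈σt , s↔T) =
  from-summand (Summand-subst⁻ t s∈σt)
  where
    open Visible α vis
    live-u = ¬HasZeroFactor⇒FactorsLive σ u ¬0f-u

    from-summand : Σ OTerm (λ v → Summand v t × Summand s (subst σ v)) →
      Σ CTerm (λ s → Summand s (subst σ u) × α ⊢ s ↔ target α n)
    from-summand (var x , x∈t , s∈σx) =
      s , Summand-subst (var-summand-preserved sound σ live-u x∈t) s∈σx , s↔T
    from-summand (𝟘 , _ , self _)     = ⊥-elim (𝟘≁target n s↔T)
    from-summand (_ ∙ _ , _ , self _) = ⊥-elim (prefix≁target n s↔T)
    from-summand (_ ⊕ _ , ⊕∈t , _)    = ⊥-elim (Summand⇒NotSum ⊕∈t)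
    from-summand (f t' t'' , ft∈t , self _) =
      let ft⊑t = Summand⇒SubTerm ft∈t
          open FactorOfTarget n σ s↔T (FactorsLive-sub ft⊑t (¬HasZeroFactor⇒FactorsLive σ t ¬0f-t))
          (z , z∈t'') = right-var-summand (≤-trans (length-summands-factor-≤ ft∈t) (<⇒≤ size<n))
          z∉t' = right-var-fresh (SummandsLive-sub (SubTerm-trans (inFR here) ft⊑t)
                                    (¬HasZeroSummand⇒SummandsLive σ t ¬0s-t)) z∈t''
          (_ , _ , w∈u , w-left-α) = sync-summand-matched sound σ live-u ft∈t z∈t'' z∉t' step dead
          w∈σu = Summand-subst w∈u (self tt)
      in _ , w∈σu , summand↔target n u↔T w∈σu w-left-α (proj₂ (live-u (Summand⇒SubTerm w∈u)))
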